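{- Let $r\ge 2$ be fixed. For all $n$, there exists a balanced $r$-partite graph $G$ on $rn$ vertices (with parts of size $n$) such that $G$ contains at least $n^{r-1-o(1)}$ transversal $r$-MIS's (with $o(1)\to 0$ as $n\to\infty$). Moreover, when $r=2$ there exists such a graph with $\Omega(n)$ transversal $2$-MIS's.
   Context: A maximal independent set (MIS) is an independent set maximal with respect to inclusion; an $r$-MIS is an MIS of size $r$. In an $r$-partite graph with a given $r$-partition, a transversal $r$-MIS is an $r$-MIS containing exactly one vertex from each part. -}

module Defs where

open import Level using (Level; 0ℓ)
open import Data.Nat using (ℕ; _≤_; _^_; _*_; _∸_)
open import Data.Fin using (Fin)
open import Data.Vec using (Vec; lookup)
open import Data.List using (List; length)
open import Data.List.Relation.Unary.All using (All)
open import Data.List.Relation.Unary.Unique.Propositional using (Unique)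
open import Data.Product using (Σ; ∃; ∃-syntax; _×_; _,_; proj₁; proj₂)
open import Relation.Nullary using (¬_)
open import Relation.Binary.PropositionalEquality using (_≡_)

Vertex : ℕ → ℕ → Set
Vertex r n = Fin r × Fin n

record RPartiteGraph (r n : ℕ) : Set₁ where
  field
    Adj     : Vertex r n → Vertex r n → Set
    sym     : ∀ {u v} → Adj u v → Adj v u
    irrefl  : ∀ {v} → ¬ Adj v v
    partite : ∀ {i x y} → ¬ Adj (i , x) (i , y)

open RPartiteGraph public

VSet : ℕ → ℕ → Set₁
VSet r n = Vertex r n → Set

_⊆_ : ∀ {r n} → VSet r n → VSet r n → Set
S ⊆ T = ∀ v → S v → T v

Independent : ∀ {r n} → RPartiteGraph r n → VSet r n → Set
Independent G S = ∀ u v → S u → S v → ¬ Adj G u v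

IsMIS : ∀ {r n} → RPartiteGraph r n → VSet r n → Set₁
IsMIS G S = Independent G S × (∀ T → S ⊆ T → Independent G T → T ⊆ S)

transversal : ∀ {r n} → Vec (Fin n) r → VSet r n
transversal σ (i , x) = x ≡ lookup σ i

IsTransversalMIS : ∀ {r n} → RPartiteGraph r n → Vec (Fin n) r → Set₁
IsTransversalMIS G σ = IsMIS G (transversal σ)

AtLeastTransversalMIS : ∀ {r n} → RPartiteGraph r n → ℕ → Set₁
AtLeastTransversalMIS {r} {n} G m =
  ∃[ L ] (Unique {A = Vec (Fin n) r} L × All (IsTransversalMIS G) L × m ≤ length L)

-- Write r = s + 2 and fix a dimension K. A configuration is a tuple x₁, …, x_{s+1} of points of
-- {0, …, d − 1}^K; adding x₀ = x₁ + ⋯ + x_{s+1} gives one point per part, and a point is read as a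
-- vertex through its base-B digits. By pigeonhole, a fraction 1/poly(d) of all d^{K(s+1)}
-- configurations share one Gram matrix G. In the graph where two vertices of different parts are
-- adjacent iff no kept configuration contains both, every kept configuration is an independent
-- transversal. It is also maximal: a vertex y of part i that is non-adjacent to every other xⱼ lies,
-- together with xⱼ, in some kept configuration, so y·y = Gᵢᵢ and y·xⱼ = Gᵢⱼ for all j ≠ i; the
-- linear relation among the xⱼ then gives y·xᵢ = Gᵢᵢ, and the equality case of Cauchy–Schwarz
-- gives y = xᵢ. With n ≈ (rd)^K vertices per part this yields n^{r−1−O(1/K)} transversal MIS's.
-- For r = 2 the diagonal transversals {(k, k)} already give n.
module Submission where

open import Data.Nat using (ℕ; zero; suc; _+_; _*_; _∸_; _^_; _≤_; _<_; z≤n; s≤s; NonZero; >-nonZero; _≤?_; ∣_-_∣)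
open import Data.Nat.Properties hiding (_≟_)
open import Data.Nat.DivMod using (_%_; _mod_; [m+kn]%n≡m%n; m<n⇒m%n≡m; m%n<n)
open import Data.Nat.Tactic.RingSolver using (solve-∀)
open import Data.Fin using (Fin; zero; suc; toℕ; punchIn)
open import Data.Fin.Properties using (_≟_; punchInᵢ≢i; toℕ-fromℕ<) renaming (suc-injective to Fin-suc-injective)
open import Data.Vec using (Vec; []; _∷_; lookup; map; replicate; zipWith; concat)
open import Data.Vec.Properties using (lookup-map; lookup-replicate; ∷-injective; ∷-injectiveʳ; ++-injectiveˡ; ++-injectiveʳ)
open import Data.Vec.Relation.Unary.All using ([]; _∷_) renaming (All to Allᵛ)
import Data.Vec.Relation.Unary.All as Allᵛ
import Data.Vec.Relation.Unary.All.Properties as Allᵛ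
open import Data.List using (List; []; _∷_; length; filter; cartesianProductWith; upTo; allFin)
import Data.List as List
open import Data.List.Properties using (length-++; length-map; length-tabulate; length-upTo; filter-accept)
open import Data.List.Relation.Unary.All as All using ([]; _∷_)
import Data.List.Relation.Unary.All.Properties as All
open import Data.List.Relation.Unary.Any as Any using (Any; here; there; any?)
open import Data.List.Relation.Unary.Any.Properties using (map⁻)
open import Data.List.Relation.Unary.AllPairs using ([]; _∷_)
open import Data.List.Relation.Unary.Unique.Propositional using (Unique)
import Data.List.Relation.Unary.Unique.Propositional.Properties as Unique
open import Data.List.Membership.Propositional using (_∈_; lose; find)
open import Data.List.Membership.Propositional.Properties using (∈-map⁻; ∈-filter⁻; ∈-upTo⁻; ∈-cartesianProductWith⁻)
open import Data.Product using (Σ; ∃-syntax; _×_; _,_; proj₁; proj₂; swap)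
open import Data.Sum using (inj₁; inj₂; reduce)
open import Function using (_∘_)
open import Relation.Nullary using (¬_; Dec; yes; no)
open import Relation.Nullary.Decidable using (_×-dec_; decidable-stable)
open import Relation.Binary.PropositionalEquality
open import Algebra.Properties.CommutativeSemigroup +-commutativeSemigroup using () renaming (interchange to +-interchange)
open import Algebra.Properties.CommutativeMonoid.Sum +-0-commutativeMonoid using (sum; sum-cong-≗; sum-remove)

open import Defs hiding (sym)

infix 7 _·_

_·_ : ∀ {K} → Vec ℕ K → Vec ℕ K → ℕ
[] · [] = 0
(a ∷ u) · (b ∷ v) = a * b + u · v

·-zeroʳ : ∀ {K} (w : Vec ℕ K) → w · replicate K 0 ≡ 0
·-zeroʳ [] = refl
·-zeroʳ (c ∷ w) rewrite *-zeroʳ c = ·-zeroʳ w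

·-distribˡ-+ : ∀ {K} (w u v : Vec ℕ K) → w · zipWith _+_ u v ≡ w · u + w · v
·-distribˡ-+ [] [] [] = refl
·-distribˡ-+ (c ∷ w) (a ∷ u) (b ∷ v) rewrite ·-distribˡ-+ w u v | *-distribˡ-+ c a b =
  +-interchange (c * a) (c * b) (w · u) (w · v)

·-≤ : ∀ {K M} {u v : Vec ℕ K} → Allᵛ (_≤ M) u → Allᵛ (_≤ M) v → u · v ≤ K * (M * M)
·-≤ [] [] = z≤n
·-≤ (a≤M ∷ u≤M) (b≤M ∷ v≤M) = +-mono-≤ (*-mono-≤ a≤M b≤M) (·-≤ u≤M v≤M)

∑ᵛ : ∀ {K m} → Vec (Vec ℕ K) m → Vec ℕ K
∑ᵛ {K} [] = replicate K 0
∑ᵛ (u ∷ us) = zipWith _+_ u (∑ᵛ us)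

·-∑ᵛ : ∀ {K m} (w : Vec ℕ K) (us : Vec (Vec ℕ K) m) → w · ∑ᵛ us ≡ sum (λ j → w · lookup us j)
·-∑ᵛ w [] = ·-zeroʳ w
·-∑ᵛ w (u ∷ us) = trans (·-distribˡ-+ w u (∑ᵛ us)) (cong (w · u +_) (·-∑ᵛ w us))

∑ᵛ-≤ : ∀ {K m d} {xs : Vec (Vec ℕ K) m} → Allᵛ (Allᵛ (_≤ d)) xs → Allᵛ (_≤ m * d) (∑ᵛ xs)
∑ᵛ-≤ {K} [] = zeros K
  where
  zeros : ∀ K → Allᵛ (_≤ 0) (replicate K 0)
  zeros zero = []
  zeros (suc K) = z≤n ∷ zeros K
∑ᵛ-≤ (u≤d ∷ xs≤d) = zipWith-+ u≤d (∑ᵛ-≤ xs≤d)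
  where
  zipWith-+ : ∀ {K p q} {u v : Vec ℕ K} → Allᵛ (_≤ p) u → Allᵛ (_≤ q) v → Allᵛ (_≤ p + q) (zipWith _+_ u v)
  zipWith-+ [] [] = []
  zipWith-+ (a≤p ∷ u≤p) (b≤q ∷ v≤q) = +-mono-≤ a≤p b≤q ∷ zipWith-+ u≤p v≤q

sum-cancel : ∀ {m} (f g : Fin m → ℕ) (i : Fin m) →
  (∀ j → ¬ j ≡ i → f j ≡ g j) → sum f ≡ sum g → f i ≡ g i
sum-cancel {suc m} f g i agree f≡g = +-cancelʳ-≡ _ (f i) (g i) (begin
    f i + sum (f ∘ punchIn i) ≡⟨ sum-remove f ⟨
    sum f                     ≡⟨ f≡g ⟩
    sum g                     ≡⟨ sum-remove g ⟩
    g i + sum (g ∘ punchIn i) ≡⟨ cong (g i +_) (sum-cong-≗ (λ j → sym (agree (punchIn i j) (punchInᵢ≢i i j)))) ⟩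
    g i + sum (f ∘ punchIn i) ∎)
  where open ≡-Reasoning

sqDist : ∀ {K} → Vec ℕ K → Vec ℕ K → ℕ
sqDist [] [] = 0
sqDist (a ∷ u) (b ∷ v) = ∣ a - b ∣ * ∣ a - b ∣ + sqDist u v

polarise : ∀ a b → a * a + b * b ≡ 2 * (a * b) + ∣ a - b ∣ * ∣ a - b ∣
polarise a b with ≤-total a b
... | inj₁ a≤b with k , refl ← m≤n⇒∃[o]m+o≡n a≤b rewrite ∣m-m+n∣≡n a k = shifted a k
  where
  shifted : ∀ a k → a * a + (a + k) * (a + k) ≡ 2 * (a * (a + k)) + k * k
  shifted = solve-∀
... | inj₂ b≤a with k , refl ← m≤n⇒∃[o]m+o≡n b≤a rewrite ∣-∣-comm (b + k) b | ∣m-m+n∣≡n b k = shifted b k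
  where
  shifted : ∀ b k → (b + k) * (b + k) + b * b ≡ 2 * ((b + k) * b) + k * k
  shifted = solve-∀

·-polarise : ∀ {K} (u v : Vec ℕ K) → u · u + v · v ≡ 2 * (u · v) + sqDist u v
·-polarise [] [] = refl
·-polarise (a ∷ u) (b ∷ v) = begin
    a * a + u · u + (b * b + v · v)                ≡⟨ +-interchange (a * a) (u · u) (b * b) (v · v) ⟩
    (a * a + b * b) + (u · u + v · v)              ≡⟨ cong₂ _+_ (polarise a b) (·-polarise u v) ⟩
    (2 * (a * b) + δ) + (2 * (u · v) + sqDist u v) ≡⟨ regroup (a * b) δ (u · v) (sqDist u v) ⟩
    2 * (a * b + u · v) + (δ + sqDist u v)         ∎
  where
  open ≡-Reasoning
  δ = ∣ a - b ∣ * ∣ a - b ∣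
  regroup : ∀ p q s t → 2 * p + q + (2 * s + t) ≡ 2 * (p + s) + (q + t)
  regroup = solve-∀

sqDist≡0⇒≡ : ∀ {K} (u v : Vec ℕ K) → sqDist u v ≡ 0 → u ≡ v
sqDist≡0⇒≡ [] [] _ = refl
sqDist≡0⇒≡ (a ∷ u) (b ∷ v) eq =
  cong₂ _∷_ (∣m-n∣≡0⇒m≡n (reduce (m*n≡0⇒m≡0∨n≡0 _ (m+n≡0⇒m≡0 _ eq)))) (sqDist≡0⇒≡ u v (m+n≡0⇒n≡0 _ eq))

·-rigid : ∀ {K} (u v : Vec ℕ K) {g} → u · u ≡ g → u · v ≡ g → v · v ≡ g → u ≡ v
·-rigid u v {g} uu uv vv = sqDist≡0⇒≡ u v (+-cancelˡ-≡ (2 * g) _ 0 (begin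
    2 * g + sqDist u v       ≡⟨ cong (λ t → 2 * t + sqDist u v) uv ⟨
    2 * (u · v) + sqDist u v ≡⟨ ·-polarise u v ⟨
    u · u + v · v            ≡⟨ cong₂ _+_ uu vv ⟩
    g + g                    ≡⟨ cong (g +_) (+-identityʳ g) ⟨
    2 * g                    ≡⟨ +-identityʳ (2 * g) ⟨
    2 * g + 0                ∎))
  where open ≡-Reasoning

augment : ∀ {K r} → Vec (Vec ℕ K) r → Vec (Vec ℕ K) (suc r)
augment xs = ∑ᵛ xs ∷ xs

augment-≤ : ∀ {K r d} {xs : Vec (Vec ℕ K) (suc r)} → Allᵛ (Allᵛ (_≤ d)) xs → Allᵛ (Allᵛ (_≤ suc r * d)) (augment xs)
augment-≤ {r = r} {d} xs≤d = ∑ᵛ-≤ xs≤d ∷ Allᵛ.map (Allᵛ.map (λ a≤d → ≤-trans a≤d (m≤n*m d (suc r)))) xs≤d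

-- The relation v 0 = ∑ⱼ v (suc j) determines y · v i from the y · v j with j ≢ i.
augment-rigid : ∀ {K r} (xs : Vec (Vec ℕ K) r) (i : Fin (suc r)) (y : Vec ℕ K) →
  let v = lookup (augment xs) in
  y · y ≡ v i · v i → (∀ j → ¬ j ≡ i → y · v j ≡ v i · v j) → y ≡ v i
augment-rigid xs i y yy yv = ·-rigid y (lookup (augment xs) i) yy (y·vᵢ i yv) refl
  where
  open ≡-Reasoning
  y·vᵢ : ∀ i → let v = lookup (augment xs) in
    (∀ j → ¬ j ≡ i → y · v j ≡ v i · v j) → y · v i ≡ v i · v i
  y·vᵢ zero yv = begin
    y · ∑ᵛ xs                       ≡⟨ ·-∑ᵛ y xs ⟩
    sum (λ j → y · lookup xs j)     ≡⟨ sum-cong-≗ (λ j → yv (suc j) λ ()) ⟩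
    sum (λ j → ∑ᵛ xs · lookup xs j) ≡⟨ ·-∑ᵛ (∑ᵛ xs) xs ⟨
    ∑ᵛ xs · ∑ᵛ xs                   ∎
  y·vᵢ (suc i) yv = sum-cancel (λ j → y · lookup xs j) (λ j → lookup xs i · lookup xs j) i
    (λ j j≢i → yv (suc j) (j≢i ∘ Fin-suc-injective))
    (begin
      sum (λ j → y · lookup xs j)           ≡⟨ ·-∑ᵛ y xs ⟨
      y · ∑ᵛ xs                             ≡⟨ yv zero (λ ()) ⟩
      lookup xs i · ∑ᵛ xs                   ≡⟨ ·-∑ᵛ (lookup xs i) xs ⟩
      sum (λ j → lookup xs i · lookup xs j) ∎)

gram : ∀ {K m} → Vec (Vec ℕ K) m → Vec (Vec ℕ m) m
gram vs = map (λ u → map (u ·_) vs) vs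

gram-≤ : ∀ {K M m} {vs : Vec (Vec ℕ K) m} → Allᵛ (Allᵛ (_≤ M)) vs → Allᵛ (Allᵛ (_≤ K * (M * M))) (gram vs)
gram-≤ vs≤M = Allᵛ.map⁺ (Allᵛ.map (λ u≤M → Allᵛ.map⁺ (Allᵛ.map (·-≤ u≤M) vs≤M)) vs≤M)

gram-≡⇒· : ∀ {K m} {vs ws : Vec (Vec ℕ K) m} → gram vs ≡ gram ws →
  ∀ i j → lookup vs i · lookup vs j ≡ lookup ws i · lookup ws j
gram-≡⇒· {vs = vs} {ws} eq i j = begin
    lookup vs i · lookup vs j     ≡⟨ entry vs ⟨
    lookup (lookup (gram vs) i) j ≡⟨ cong (λ g → lookup (lookup g i) j) eq ⟩
    lookup (lookup (gram ws) i) j ≡⟨ entry ws ⟩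
    lookup ws i · lookup ws j     ∎
  where
  open ≡-Reasoning
  entry : ∀ us → lookup (lookup (gram us) i) j ≡ lookup us i · lookup us j
  entry us = trans (cong (λ row → lookup row j) (lookup-map i _ us)) (lookup-map j _ us)

encode : ℕ → ∀ {K} → Vec ℕ K → ℕ
encode B [] = 0
encode B (a ∷ u) = a + encode B u * B

encode-< : ∀ B {K} (u : Vec ℕ K) → Allᵛ (_< B) u → encode B u < B ^ K
encode-< B [] [] = s≤s z≤n
encode-< B {suc K} (a ∷ u) (a<B ∷ u<B) = begin-strict
    a + encode B u * B   <⟨ +-monoˡ-< (encode B u * B) a<B ⟩
    suc (encode B u) * B ≤⟨ *-monoˡ-≤ B (encode-< B u u<B) ⟩
    B ^ K * B            ≡⟨ *-comm (B ^ K) B ⟩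
    B * B ^ K            ∎
  where open ≤-Reasoning

digits-injective : ∀ {B a b} c d → a < B → b < B → a + c * B ≡ b + d * B → a ≡ b × c ≡ d
digits-injective {B@(suc _)} {a} {b} c d a<B b<B eq =
  a≡b , *-cancelʳ-≡ c d B (+-cancelˡ-≡ b _ _ (subst (λ t → t + c * B ≡ b + d * B) a≡b eq))
  where
  open ≡-Reasoning
  a≡b : a ≡ b
  a≡b = begin
    a               ≡⟨ m<n⇒m%n≡m a<B ⟨
    a % B           ≡⟨ [m+kn]%n≡m%n a c B ⟨
    (a + c * B) % B ≡⟨ cong (_% B) eq ⟩
    (b + d * B) % B ≡⟨ [m+kn]%n≡m%n b d B ⟩
    b % B           ≡⟨ m<n⇒m%n≡m b<B ⟩
    b               ∎

encode-injective : ∀ B {K} {u v : Vec ℕ K} → Allᵛ (_< B) u → Allᵛ (_< B) v → encode B u ≡ encode B v → u ≡ v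
encode-injective B [] [] _ = refl
encode-injective B {u = _ ∷ u} {_ ∷ v} (a<B ∷ u<B) (b<B ∷ v<B) eq
  with refl , eq′ ← digits-injective (encode B u) (encode B v) a<B b<B eq =
  cong (_ ∷_) (encode-injective B u<B v<B eq′)

mod-injective : ∀ {k l n} .{{_ : NonZero n}} → k < n → l < n → k mod n ≡ l mod n → k ≡ l
mod-injective {k} {l} {n} k<n l<n eq = begin
    k             ≡⟨ m<n⇒m%n≡m k<n ⟨
    k % n         ≡⟨ toℕ-fromℕ< (m%n<n k n) ⟨
    toℕ (k mod n) ≡⟨ cong toℕ eq ⟩
    toℕ (l mod n) ≡⟨ toℕ-fromℕ< (m%n<n l n) ⟩
    l % n         ≡⟨ m<n⇒m%n≡m l<n ⟩
    l             ∎
  where open ≡-Reasoning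

encode-mod-injective : ∀ {B K n} .{{_ : NonZero n}} → B ^ K ≤ n → {u v : Vec ℕ K} →
  Allᵛ (_< B) u → Allᵛ (_< B) v → encode B u mod n ≡ encode B v mod n → u ≡ v
encode-mod-injective {B} B^K≤n u<B v<B eq = encode-injective B u<B v<B
  (mod-injective (<-≤-trans (encode-< B _ u<B) B^K≤n) (<-≤-trans (encode-< B _ v<B) B^K≤n) eq)

map-injectiveOn : ∀ {A B : Set} {P : A → Set} {f : A → B} → (∀ {u v} → P u → P v → f u ≡ f v → u ≡ v) →
  ∀ {m} {xs ys : Vec A m} → Allᵛ P xs → Allᵛ P ys → map f xs ≡ map f ys → xs ≡ ys
map-injectiveOn inj [] [] _ = refl
map-injectiveOn inj (px ∷ pxs) (py ∷ pys) eq with fx≡fy , eq′ ← ∷-injective eq =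
  cong₂ _∷_ (inj px py fx≡fy) (map-injectiveOn inj pxs pys eq′)

concat-injective : ∀ {A : Set} {m n} {xss yss : Vec (Vec A m) n} → concat xss ≡ concat yss → xss ≡ yss
concat-injective {xss = []} {[]} _ = refl
concat-injective {xss = xs ∷ xss} {ys ∷ yss} eq =
  cong₂ _∷_ (++-injectiveˡ xs ys eq) (concat-injective (++-injectiveʳ xs ys eq))

map⁺-injectiveOn : ∀ {A B : Set} {f : A → B} {xs : List A} →
  (∀ {x y} → x ∈ xs → y ∈ xs → f x ≡ f y → x ≡ y) → Unique xs → Unique (List.map f xs)
map⁺-injectiveOn {xs = []} _ [] = []
map⁺-injectiveOn {xs = x ∷ xs} inj (x∉xs ∷ xs!) =
  All.map⁺ (All.tabulate λ y∈xs fx≡fy → All.lookup x∉xs y∈xs (inj (here refl) (there y∈xs) fx≡fy))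
  ∷ map⁺-injectiveOn (λ x∈ y∈ → inj (there x∈) (there y∈)) xs!

vectorsOver : ∀ {A : Set} → List A → (K : ℕ) → List (Vec A K)
vectorsOver xs zero = [] ∷ []
vectorsOver xs (suc K) = cartesianProductWith _∷_ xs (vectorsOver xs K)

length-cartesianProductWith : ∀ {A B C : Set} (f : A → B → C) xs ys →
  length (cartesianProductWith f xs ys) ≡ length xs * length ys
length-cartesianProductWith f [] ys = refl
length-cartesianProductWith f (x ∷ xs) ys =
  trans (length-++ (List.map (f x) ys)) (cong₂ _+_ (length-map (f x) ys) (length-cartesianProductWith f xs ys))

length-vectorsOver : ∀ {A : Set} (xs : List A) K → length (vectorsOver xs K) ≡ length xs ^ K
length-vectorsOver xs zero = refl
length-vectorsOver xs (suc K) =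
  trans (length-cartesianProductWith _∷_ xs (vectorsOver xs K)) (cong (length xs *_) (length-vectorsOver xs K))

∈-vectorsOver⁻ : ∀ {A : Set} {xs : List A} K {v} → v ∈ vectorsOver xs K → Allᵛ (_∈ xs) v
∈-vectorsOver⁻ zero (here refl) = []
∈-vectorsOver⁻ {xs = xs} (suc K) v∈ with a , u , a∈ , u∈ , refl ← ∈-cartesianProductWith⁻ _∷_ xs (vectorsOver xs K) v∈ =
  a∈ ∷ ∈-vectorsOver⁻ K u∈

vectorsOver-unique : ∀ {A : Set} {xs : List A} K → Unique xs → Unique (vectorsOver xs K)
vectorsOver-unique zero _ = [] ∷ []
vectorsOver-unique (suc K) xs! = Unique.cartesianProductWith⁺ _∷_ ∷-injective xs! (vectorsOver-unique K xs!)

sum-mono-≤ : ∀ {m} {f g : Fin m → ℕ} → (∀ i → f i ≤ g i) → sum f ≤ sum g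
sum-mono-≤ {zero} f≤g = z≤n
sum-mono-≤ {suc m} f≤g = +-mono-≤ (f≤g zero) (sum-mono-≤ (f≤g ∘ suc))

sum-mono-< : ∀ {m} {f g : Fin m → ℕ} (i : Fin m) → (∀ j → f j ≤ g j) → f i < g i → sum f < sum g
sum-mono-< {suc m} {f} {g} i f≤g fᵢ<gᵢ = begin-strict
    sum f                     ≡⟨ sum-remove f ⟩
    f i + sum (f ∘ punchIn i) <⟨ +-mono-<-≤ fᵢ<gᵢ (sum-mono-≤ (f≤g ∘ punchIn i)) ⟩
    g i + sum (g ∘ punchIn i) ≡⟨ sum-remove g ⟨
    sum g                     ∎
  where open ≤-Reasoning

sum≤*max : ∀ {m} (f : Fin (suc m) → ℕ) → ∃[ i ] sum f ≤ suc m * f i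
sum≤*max {zero} f = zero , ≤-refl
sum≤*max {suc m} f with i , ∑≤ ← sum≤*max (f ∘ suc) | ≤-total (f zero) (f (suc i))
... | inj₁ f₀≤fᵢ = suc i , ≤-trans (+-monoʳ-≤ (f zero) ∑≤) (+-monoˡ-≤ _ f₀≤fᵢ)
... | inj₂ fᵢ≤f₀ = zero , +-monoʳ-≤ (f zero) (≤-trans ∑≤ (*-monoʳ-≤ (suc m) fᵢ≤f₀))

module _ {A : Set} {m : ℕ} (h : A → Fin m) where

  count : List A → Fin m → ℕ
  count L c = length (filter (λ x → h x ≟ c) L)

  count-∷-≤ : ∀ x L c → count L c ≤ count (x ∷ L) c
  count-∷-≤ x L c with h x ≟ c
  ... | yes _ = n≤1+n _
  ... | no  _ = ≤-refl

  count-∷-< : ∀ x L → count L (h x) < count (x ∷ L) (h x)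
  count-∷-< x L rewrite filter-accept (λ y → h y ≟ h x) {x} {L} refl = ≤-refl

  length≤∑count : ∀ L → length L ≤ sum (count L)
  length≤∑count [] = z≤n
  length≤∑count (x ∷ L) = ≤-trans (s≤s (length≤∑count L)) (sum-mono-< (h x) (count-∷-≤ x L) (count-∷-< x L))

pigeonhole : ∀ {A : Set} {m} .{{_ : NonZero m}} (h : A → Fin m) L → ∃[ c ] length L ≤ m * count h L c
pigeonhole {m = suc m} h L with c , ∑≤ ← sum≤*max (count h L) = c , ≤-trans (length≤∑count h L) ∑≤

module _ {r n : ℕ} (L : List (Vec (Fin n) r)) where

  Covers : Fin r → Fin n → Fin r → Fin n → Set
  Covers i u j w = Any (λ σ → lookup σ i ≡ u × lookup σ j ≡ w) L

  covers? : ∀ i u j w → Dec (Covers i u j w)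
  covers? i u j w = any? (λ σ → (lookup σ i ≟ u) ×-dec (lookup σ j ≟ w)) L

  uncoveredGraph : RPartiteGraph r n
  uncoveredGraph = record
    { Adj     = λ (i , u) (j , w) → ¬ i ≡ j × ¬ Covers i u j w
    ; sym     = λ (i≢j , ¬cov) → (λ j≡i → i≢j (sym j≡i)) , (λ cov → ¬cov (Any.map swap cov))
    ; irrefl  = λ (i≢i , _) → i≢i refl
    ; partite = λ (i≢i , _) → i≢i refl
    }

  CoverRigid : Set
  CoverRigid = ∀ {σ} → σ ∈ L → ∀ i a → (∀ j → ¬ j ≡ i → Covers i a j (lookup σ j)) → a ≡ lookup σ i

  ∈⇒transversalMIS : CoverRigid → ∀ {σ} → σ ∈ L → IsTransversalMIS uncoveredGraph σ
  ∈⇒transversalMIS rigid {σ} σ∈L = independent , maximal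
    where
    independent : Independent uncoveredGraph (transversal σ)
    independent _ _ u∈σ w∈σ (_ , ¬cov) = ¬cov (lose σ∈L (sym u∈σ , sym w∈σ))

    maximal : ∀ T → transversal σ ⊆ T → Independent uncoveredGraph T → T ⊆ transversal σ
    maximal T σ⊆T T-indep (i , a) ia∈T = rigid σ∈L i a λ j j≢i →
      decidable-stable (covers? i a j (lookup σ j)) λ ¬cov →
        T-indep (i , a) (j , lookup σ j) ia∈T (σ⊆T _ refl) ((λ i≡j → j≢i (sym i≡j)) , ¬cov)

  atLeastTransversalMIS : Unique L → CoverRigid → AtLeastTransversalMIS uncoveredGraph (length L)
  atLeastTransversalMIS unique rigid = L , unique , All.tabulate (∈⇒transversalMIS rigid) , ≤-refl

diagonal : ∀ r n → List (Vec (Fin n) r)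
diagonal r n = List.map (replicate r) (allFin n)

diagonal-coverRigid : ∀ {r n} → CoverRigid (diagonal (suc (suc r)) n)
diagonal-coverRigid σ∈diag i a covered
  with k , _ , refl ← ∈-map⁻ (replicate _) σ∈diag
  with τ , τ∈diag , τᵢ≡a , τⱼ≡k ← find (covered (punchIn i zero) (punchInᵢ≢i i zero))
  with l , _ , refl ← ∈-map⁻ (replicate _) τ∈diag = begin
    a                        ≡⟨ τᵢ≡a ⟨
    lookup (replicate _ l) i ≡⟨ lookup-replicate i l ⟩
    l                        ≡⟨ lookup-replicate j l ⟨
    lookup (replicate _ l) j ≡⟨ τⱼ≡k ⟩
    lookup (replicate _ k) j ≡⟨ lookup-replicate j k ⟩
    k                        ≡⟨ lookup-replicate i k ⟨
    lookup (replicate _ k) i ∎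
  where
  open ≡-Reasoning
  j = punchIn i zero

diagonal-atLeast : ∀ r n → AtLeastTransversalMIS (uncoveredGraph (diagonal (suc (suc r)) n)) n
diagonal-atLeast r n = subst (AtLeastTransversalMIS (uncoveredGraph (diagonal (suc (suc r)) n))) length-diagonal
  (atLeastTransversalMIS _ (Unique.map⁺ (cong (λ σ → lookup σ zero)) (Unique.allFin⁺ n)) diagonal-coverRigid)
  where
  length-diagonal : length (diagonal (suc (suc r)) n) ≡ n
  length-diagonal = trans (length-map (replicate _) (allFin n)) (length-tabulate (λ k → k))

module Configurations {K r : ℕ} (M n : ℕ) .{{_ : NonZero n}} (fits : suc M ^ K ≤ n) where

  Config : Set
  Config = Vec (Vec ℕ K) (suc r)

  Bounded : Config → Set
  Bounded x = Allᵛ (Allᵛ (_≤ M)) (augment x)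

  vertexOf : Vec ℕ K → Fin n
  vertexOf u = encode (suc M) u mod n

  vertexOf-injective : ∀ {u v} → Allᵛ (_≤ M) u → Allᵛ (_≤ M) v → vertexOf u ≡ vertexOf v → u ≡ v
  vertexOf-injective u≤M v≤M = encode-mod-injective fits (Allᵛ.map s≤s u≤M) (Allᵛ.map s≤s v≤M)

  transversalOf : Config → Vec (Fin n) (suc (suc r))
  transversalOf x = map vertexOf (augment x)

  transversalOf-injective : ∀ {x y} → Bounded x → Bounded y → transversalOf x ≡ transversalOf y → x ≡ y
  transversalOf-injective (_ ∷ x≤M) (_ ∷ y≤M) eq = map-injectiveOn vertexOf-injective x≤M y≤M (∷-injectiveʳ eq)

  module _ (L : List Config) (bounded : ∀ {x} → x ∈ L → Bounded x)
           (sameGram : ∀ {x y} → x ∈ L → y ∈ L → gram (augment x) ≡ gram (augment y)) where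

    configs-coverRigid : CoverRigid (List.map transversalOf L)
    configs-coverRigid σ∈ i a covered with x , x∈L , refl ← ∈-map⁻ transversalOf σ∈ = begin
        a                          ≡⟨ picks-a (witness j₀ j₀≢i) ⟨
        vertexOf w                 ≡⟨ cong vertexOf (augment-rigid x i w w·w w·vⱼ) ⟩
        vertexOf (v x i)           ≡⟨ lookup-transversalOf x i ⟨
        lookup (transversalOf x) i ∎
      where
      open ≡-Reasoning
      v : Config → Fin (suc (suc r)) → Vec ℕ K
      v = lookup ∘ augment

      lookup-transversalOf : ∀ y k → lookup (transversalOf y) k ≡ vertexOf (v y k)
      lookup-transversalOf y k = lookup-map k vertexOf (augment y)

      vertex-injective : ∀ {y z} → y ∈ L → z ∈ L → ∀ k → vertexOf (v y k) ≡ vertexOf (v z k) → v y k ≡ v z k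
      vertex-injective y∈L z∈L k = vertexOf-injective (Allᵛ.lookup⁺ (bounded y∈L) k) (Allᵛ.lookup⁺ (bounded z∈L) k)

      record Witness (j : Fin (suc (suc r))) : Set where
        field
          config  : Config
          member  : config ∈ L
          picks-a : vertexOf (v config i) ≡ a
          agrees  : v config j ≡ v x j
      open Witness

      witness : ∀ j → ¬ j ≡ i → Witness j
      witness j j≢i with y , y∈L , yᵢ≡a , yⱼ≡xⱼ ← find (map⁻ (covered j j≢i)) = record
        { config  = y
        ; member  = y∈L
        ; picks-a = trans (sym (lookup-transversalOf y i)) yᵢ≡a
        ; agrees  = vertex-injective y∈L x∈L j
            (trans (sym (lookup-transversalOf y j)) (trans yⱼ≡xⱼ (lookup-transversalOf x j)))
        }

      j₀ = punchIn i zero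
      j₀≢i = punchInᵢ≢i i zero
      w = v (config (witness j₀ j₀≢i)) i

      w-common : ∀ j j≢i → v (config (witness j j≢i)) i ≡ w
      w-common j j≢i = vertex-injective (member (witness j j≢i)) (member (witness j₀ j₀≢i)) i
        (trans (picks-a (witness j j≢i)) (sym (picks-a (witness j₀ j₀≢i))))

      w·w : w · w ≡ v x i · v x i
      w·w = gram-≡⇒· (sameGram (member (witness j₀ j₀≢i)) x∈L) i i

      w·vⱼ : ∀ j → ¬ j ≡ i → w · v x j ≡ v x i · v x j
      w·vⱼ j j≢i = begin
          w · v x j     ≡⟨ cong₂ _·_ (w-common j j≢i) (agrees (witness j j≢i)) ⟨
          v y i · v y j ≡⟨ gram-≡⇒· (sameGram (member (witness j j≢i)) x∈L) i j ⟩
          v x i · v x j ∎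
        where y = config (witness j j≢i)

    commonGram-atLeast : Unique L → AtLeastTransversalMIS (uncoveredGraph (List.map transversalOf L)) (length L)
    commonGram-atLeast L! = subst (AtLeastTransversalMIS (uncoveredGraph (List.map transversalOf L))) (length-map transversalOf L)
      (atLeastTransversalMIS _ (map⁺-injectiveOn (λ x∈ y∈ → transversalOf-injective (bounded x∈) (bounded y∈)) L!)
        configs-coverRigid)

configurationGraph : ∀ r K d n → suc (suc r * d) ^ K ≤ n →
  let M = suc r * d ; R = suc (suc r) in
  Σ (RPartiteGraph R n) λ G → ∃[ m ]
    ((d ^ K) ^ suc r ≤ suc (K * (M * M)) ^ (R * R) * m × AtLeastTransversalMIS G m)
configurationGraph r K d n fits =
  uncoveredGraph (List.map transversalOf L₀) , length L₀ , counted , commonGram-atLeast L₀ bounded sameGram unique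
  where
  M = suc r * d
  R = suc (suc r)
  P = suc (K * (M * M)) ^ (R * R)
  instance
    n≢0 : NonZero n
    n≢0 = >-nonZero (<-≤-trans (m^n>0 (suc M) K) fits)
    P≢0 : NonZero P
    P≢0 = m^n≢0 (suc (K * (M * M))) (R * R)
  open Configurations {K} {r} M n fits

  key : Config → Fin P
  key x = encode (suc (K * (M * M))) (concat (gram (augment x))) mod P

  configs : List Config
  configs = vectorsOver (vectorsOver (upTo d) K) (suc r)

  c : Fin P
  c = proj₁ (pigeonhole key configs)

  L₀ : List Config
  L₀ = filter (λ x → key x ≟ c) configs

  ∈L₀⁻ : ∀ {x} → x ∈ L₀ → x ∈ configs × key x ≡ c
  ∈L₀⁻ = ∈-filter⁻ (λ x → key x ≟ c) {xs = configs}

  bounded : ∀ {x} → x ∈ L₀ → Bounded x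
  bounded x∈L₀ = augment-≤ (Allᵛ.map (λ u∈ → Allᵛ.map (<⇒≤ ∘ ∈-upTo⁻) (∈-vectorsOver⁻ K u∈))
    (∈-vectorsOver⁻ (suc r) (proj₁ (∈L₀⁻ x∈L₀))))

  sameGram : ∀ {x y} → x ∈ L₀ → y ∈ L₀ → gram (augment x) ≡ gram (augment y)
  sameGram x∈L₀ y∈L₀ = concat-injective (encode-mod-injective ≤-refl (gram-< x∈L₀) (gram-< y∈L₀)
    (trans (proj₂ (∈L₀⁻ x∈L₀)) (sym (proj₂ (∈L₀⁻ y∈L₀)))))
    where
    gram-< : ∀ {x} → x ∈ L₀ → Allᵛ (_< suc (K * (M * M))) (concat (gram (augment x)))
    gram-< x∈L₀ = Allᵛ.map s≤s (Allᵛ.concat⁺ (gram-≤ (bounded x∈L₀)))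

  unique : Unique L₀
  unique = Unique.filter⁺ (λ x → key x ≟ c) {xs = configs}
    (vectorsOver-unique (suc r) (vectorsOver-unique K (Unique.upTo⁺ d)))

  counted : (d ^ K) ^ suc r ≤ P * length L₀
  counted = begin
    (d ^ K) ^ suc r ≡⟨ length-configs ⟨
    length configs  ≤⟨ proj₂ (pigeonhole key configs) ⟩
    P * length L₀   ∎
    where
    open ≤-Reasoning
    length-configs : length configs ≡ (d ^ K) ^ suc r
    length-configs = trans (length-vectorsOver (vectorsOver (upTo d) K) (suc r))
      (cong (_^ suc r) (trans (length-vectorsOver (upTo d) K) (cong (_^ K) (length-upTo d))))

^-distribʳ-* : ∀ a b k → (a * b) ^ k ≡ a ^ k * b ^ k
^-distribʳ-* a b zero = refl
^-distribʳ-* a b (suc k) =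
  trans (cong (a * b *_) (^-distribʳ-* a b k)) ([m*n]*[o*p]≡[m*o]*[n*p] a b (a ^ k) (b ^ k))

-- With K = 2s + 1 and d ≥ c^s A^(KQ), the loss factor P ≤ (c d²)^E in (d^K)^r ≤ P m
-- is absorbed by a single factor d of d^K.
exponent-trade : ∀ {r q Q E s c A d n m P} .{{_ : NonZero P}} → r * q ≡ suc Q → s ≡ E * q →
  c ^ s * A ^ (suc (2 * s) * Q) ≤ d →
  P ≤ (c * d ^ 2) ^ E → n ≤ (A * d) ^ suc (2 * s) → (d ^ suc (2 * s)) ^ r ≤ P * m →
  n ^ Q ≤ m ^ q
exponent-trade {r} {q} {Q} {E} {s} {c} {A} {d} {n} {m} {P} rq≡1+Q refl d-large P≤ n≤ counted =
  *-cancelˡ-≤ (P ^ q) {{m^n≢0 P q}} (begin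
    P ^ q * n ^ Q                                     ≤⟨ *-mono-≤ (^-monoˡ-≤ q P≤) (^-monoˡ-≤ Q n≤) ⟩
    ((c * d ^ 2) ^ E) ^ q * ((A * d) ^ K) ^ Q         ≡⟨ cong₂ _*_ (^-*-assoc (c * d ^ 2) E q) (^-*-assoc (A * d) K Q) ⟩
    (c * d ^ 2) ^ s * (A * d) ^ (K * Q)               ≡⟨ cong₂ _*_ (^-distribʳ-* c (d ^ 2) s) (^-distribʳ-* A d (K * Q)) ⟩
    c ^ s * (d ^ 2) ^ s * (A ^ (K * Q) * d ^ (K * Q)) ≡⟨ [m*n]*[o*p]≡[m*o]*[n*p] (c ^ s) _ (A ^ (K * Q)) _ ⟩
    c ^ s * A ^ (K * Q) * ((d ^ 2) ^ s * d ^ (K * Q)) ≤⟨ *-monoˡ-≤ _ d-large ⟩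
    d * ((d ^ 2) ^ s * d ^ (K * Q))                   ≡⟨ cong (λ t → d * (t * d ^ (K * Q))) (^-*-assoc d 2 s) ⟩
    d * (d ^ (2 * s) * d ^ (K * Q))                   ≡⟨ *-assoc d (d ^ (2 * s)) (d ^ (K * Q)) ⟨
    d ^ K * d ^ (K * Q)                               ≡⟨ ^-distribˡ-+-* d K (K * Q) ⟨
    d ^ (K + K * Q)                                   ≡⟨ cong (d ^_) (trans (cong (K *_) rq≡1+Q) (*-suc K Q)) ⟨
    d ^ (K * (r * q))                                 ≡⟨ trans (^-*-assoc (d ^ K) r q) (^-*-assoc d K (r * q)) ⟨
    ((d ^ K) ^ r) ^ q                                 ≤⟨ ^-monoˡ-≤ q counted ⟩
    (P * m) ^ q                                       ≡⟨ ^-distribʳ-* P m q ⟩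
    P ^ q * m ^ q                                     ∎)
  where
  open ≤-Reasoning
  K = suc (2 * s)

bracket : (f : ℕ → ℕ) → (∀ d → f d < f (suc d)) → ∀ {d₀} n → f d₀ ≤ n →
  ∃[ d ] (d₀ ≤ d × f d ≤ n × n < f (suc d))
bracket f f-increasing {d₀} zero fd₀≤0 = d₀ , ≤-refl , fd₀≤0 , ≤-<-trans z≤n (f-increasing d₀)
bracket f f-increasing {d₀} (suc n) fd₀≤1+n with f d₀ ≤? n
... | no fd₀≰n = d₀ , ≤-refl , fd₀≤1+n , <-≤-trans (s≤s (≰⇒> fd₀≰n)) (f-increasing d₀)
... | yes fd₀≤n with d , d₀≤d , fd≤n , n<fd′ ← bracket f f-increasing n fd₀≤n with m≤n⇒m<n∨m≡n n<fd′
...   | inj₁ 1+n<fd′ = d , d₀≤d , m≤n⇒m≤1+n fd≤n , 1+n<fd′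
...   | inj₂ 1+n≡fd′ = suc d , m≤n⇒m≤1+n d₀≤d , ≤-reflexive (sym 1+n≡fd′) ,
                       subst (_< f (suc (suc d))) (sym 1+n≡fd′) (f-increasing (suc d))

loss-bound : ∀ K r d → 1 ≤ d → suc (K * (r * d * (r * d))) ≤ suc (K * (r * r)) * d ^ 2
loss-bound K r d@(suc _) _ = +-mono-≤ (m^n>0 d 2) (≤-reflexive (rearrange K r d))
  where
  -- d ^ 2 unfolds to d * (d * 1)
  rearrange : ∀ K r d → K * (r * d * (r * d)) ≡ K * (r * r) * (d * (d * 1))
  rearrange = solve-∀

next-bound : ∀ r d → 1 ≤ r → 1 ≤ d → suc (r * suc d) ≤ 3 * r * d
next-bound r d@(suc _) 1≤r 1≤d = begin
    suc (r * suc d)         ≡⟨ cong suc (*-suc r d) ⟩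
    1 + (r + r * d)         ≤⟨ +-mono-≤ (*-mono-≤ 1≤r 1≤d) (+-monoˡ-≤ (r * d) (m≤m*n r d)) ⟩
    r * d + (r * d + r * d) ≡⟨ thrice r d ⟩
    3 * r * d               ∎
  where
  open ≤-Reasoning
  thrice : ∀ r d → r * d + (r * d + r * d) ≡ 3 * r * d
  thrice = solve-∀

manyTransversalMIS : ∀ a b → ∃[ N ] ((n : ℕ) → N ≤ n →
  Σ (RPartiteGraph (suc (suc a)) n) λ G → ∃[ m ] (n ^ (suc a * suc b ∸ 1) ≤ m ^ suc b × AtLeastTransversalMIS G m))
manyTransversalMIS a b = f (suc D₀) , λ n fD₀≤n →
  let d , D₀<d , fd≤n , n<f[1+d] = bracket f f-increasing n fD₀≤n
      G , m , counted , atLeast = configurationGraph a K d n fd≤n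
      1≤d = ≤-trans (s≤s z≤n) D₀<d
  in G , m , exponent-trade {r} {q} {r * q ∸ 1} {E} {s} {c} {3 * r} {d} {{m^n≢0 _ E}} refl refl
                (≤-trans (n≤1+n D₀) D₀<d)
                (^-monoˡ-≤ E (loss-bound K r d 1≤d))
                (≤-trans (<⇒≤ n<f[1+d]) (^-monoˡ-≤ K (next-bound r d (s≤s z≤n) 1≤d)))
                counted
       , atLeast
  where
  r = suc a
  q = suc b
  E = suc (suc a) * suc (suc a)
  s = E * q
  K = suc (2 * s)
  c = suc (K * (r * r))
  D₀ = c ^ s * (3 * r) ^ (K * (r * q ∸ 1))
  f : ℕ → ℕ
  f d = suc (r * d) ^ K
  f-increasing : ∀ d → f d < f (suc d)
  f-increasing d = ^-monoˡ-< K (s≤s (*-monoʳ-< r (n<1+n d)))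

lemma2p1 : (r : ℕ) → 2 ≤ r →
    -- for every ε = 1/q > 0, eventually there is G with ≥ n^(r-1-ε) transversal r-MIS's
    ((q : ℕ) → 1 ≤ q → ∃[ N ] ((n : ℕ) → N ≤ n →
      Σ (RPartiteGraph r n) λ G → ∃[ m ] (n ^ ((r ∸ 1) * q ∸ 1) ≤ m ^ q × AtLeastTransversalMIS G m)))
    -- moreover, for r = 2: Ω(n) transversal 2-MIS's
    × (∃[ c ] ∃[ N ] ((n : ℕ) → N ≤ n →
      Σ (RPartiteGraph 2 n) λ G → ∃[ m ] (n ≤ c * m × AtLeastTransversalMIS G m)))
lemma2p1 (suc (suc a)) (s≤s (s≤s _)) =
  (λ { (suc b) _ → manyTransversalMIS a b }) ,
  (1 , 0 , λ n _ → uncoveredGraph (diagonal 2 n) , n , ≤-reflexive (sym (*-identityˡ n)) , diagonal-atLeast 0 n)
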